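{- Let $m\geq 3$ and $n\geq 2$ be integers. Then $\chi_L(K_m\square P_n)=m+2$ if $m\leq n-2$, and $\chi_L(K_m\square P_n)=m+1$ if $m\geq n-1$.
   Context: $K_m$ is the complete graph on $m$ vertices, $P_n$ the path on $n$ vertices, and $\square$ the cartesian product: $V(G\square H)=V(G)\times V(H)$, with $(a,b)\sim(a',b')$ iff ($a=a'$ and $bb'\in E(H)$) or ($aa'\in E(G)$ and $b=b'$). For a connected graph $G$, with $d$ the shortest-path distance and $d(v,S)=\min_{x\in S}d(v,x)$, a proper $k$-coloring (onto $\{1,\dots,k\}$) with ordered color classes $(V_1,\dots,V_k)$ is a locating coloring if distinct vertices $v$ have distinct color codes $(d(v,V_1),\dots,d(v,V_k))$; $\chi_L(G)$, the locating chromatic number, is the minimum $k$ for which a locating $k$-coloring exists. -}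

module Defs where

open import Level using (0ℓ)
open import Data.Nat using (ℕ; zero; suc; _+_; _≤_)
open import Data.Fin using (Fin; toℕ)
open import Data.Product using (Σ; ∃; _×_; _,_)
open import Data.Sum using (_⊎_)
open import Function.Bundles using (_⇔_)
open import Relation.Binary.PropositionalEquality using (_≡_; _≢_)

record Graph : Set₁ where
  field
    V : Set
    E : V → V → Set
open Graph public

K : ℕ → Graph
K m = record { V = Fin m ; E = λ a b → a ≢ b }

P : ℕ → Graph
P n = record { V = Fin n ; E = λ a b → (suc (toℕ a) ≡ toℕ b) ⊎ (suc (toℕ b) ≡ toℕ a) }

_□_ : Graph → Graph → Graph
G □ H = record
  { V = V G × V H
  ; E = λ { (a , b) (a' , b') → (a ≡ a' × E H b b') ⊎ (E G a a' × b ≡ b') } }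

data Walk (G : Graph) : V G → V G → ℕ → Set where
  here : ∀ {v} → Walk G v v 0
  step : ∀ {u w v k} → E G u w → Walk G w v k → Walk G u v (suc k)

Dist : (G : Graph) → V G → V G → ℕ → Set
Dist G u v k = Walk G u v k × (∀ j → Walk G u v j → k ≤ j)

Connected : Graph → Set
Connected G = ∀ u v → ∃ λ k → Walk G u v k

SetDist : (G : Graph) → V G → (V G → Set) → ℕ → Set
SetDist G v S k =
  (∃ λ x → S x × Dist G v x k) × (∀ x j → S x → Dist G v x j → k ≤ j)

-- A proper k-coloring onto {1..k} (colors indexed by Fin k)
record ProperColoring (G : Graph) (k : ℕ) : Set where
  field
    col    : V G → Fin k
    proper : ∀ u v → E G u v → col u ≢ col v
    onto   : ∀ (i : Fin k) → ∃ λ v → col v ≡ i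
open ProperColoring public

Class : {G : Graph} {k : ℕ} → ProperColoring G k → Fin k → V G → Set
Class c i v = col c v ≡ i

SameCode : {G : Graph} {k : ℕ} → ProperColoring G k → V G → V G → Set
SameCode {G} {k} c u v =
  ∀ (i : Fin k) (d : ℕ) → SetDist G u (Class c i) d ⇔ SetDist G v (Class c i) d

IsLocating : {G : Graph} {k : ℕ} → ProperColoring G k → Set
IsLocating {G} c = ∀ u v → SameCode c u v → u ≡ v

HasLocatingColoring : Graph → ℕ → Set
HasLocatingColoring G k = Σ (ProperColoring G k) IsLocating

LocChromNum : Graph → ℕ → Set
LocChromNum G k =
  HasLocatingColoring G k × (∀ j → HasLocatingColoring G j → k ≤ j)

-- With m colours every layer (copy of K m) is rainbow, so every vertex sees all other colours
-- at distance one and equally coloured vertices of two layers are twins; hence χ_L ≥ m + 1.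
-- With m + 1 colours each layer misses exactly one colour. If neither neighbouring layer of s
-- had the colour x missing from s, walking towards a layer containing x one meets adjacent
-- layers t, s missing x with x in the other neighbour p of t; then (r , s) and the vertex of t
-- coloured like it are twins at distance two from x. So every layer has a vertex seeing all
-- colours within distance one, these vertices need distinct colours, and n ≤ m + 1.
-- Conversely, m + 2 colours always suffice: two extra colours on single vertices of the end
-- layer act as landmarks whose distances reveal the layer. For n ≤ m + 1 an explicit table with
-- m + 1 colours makes the layers miss distinct colours, each seen from outside only by one
-- gate vertex of distinct colour; the table is uniform for odd m, patched on its first layers
-- for even m ≥ 6, and a finite check for m = 4.

module Submission where

open import Defs
open import Data.Nat using (ℕ; zero; suc; pred; _+_; _∸_; _⊔_; _≤_; _<_; _<?_; z≤n; s≤s; ∣_-_∣; parity)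
open import Data.Parity.Base using (Parity; 0ℙ; 1ℙ; _⁻¹)
open import Data.Parity.Properties using (⁻¹-selfInverse; suc-homo-⁻¹)
open import Data.Nat.Properties
open import Data.Fin using (Fin; toℕ; fromℕ<; punchOut)
import Data.Fin.Properties as Fin
open import Data.Product using (∃; _×_; _,_; proj₁; proj₂)
open import Data.Sum using (_⊎_; inj₁; inj₂; map₂)
open import Data.Empty using (⊥; ⊥-elim)
open import Function using (_∘_)
open import Function.Bundles using (mk⇔; Equivalence)
open import Function.Definitions using (Injective)
open import Relation.Nullary using (¬_; Dec; yes; no; ¬?)
open import Relation.Nullary.Decidable using (_×-dec_; _⊎-dec_; _→-dec_; True; toWitness)
open import Relation.Binary.PropositionalEquality

module _ {G : Graph} where

  walk-length-zero : ∀ {u v} → Walk G u v 0 → u ≡ v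
  walk-length-zero here = refl

  SetDist-unique : ∀ {v S d d'} → SetDist G v S d → SetDist G v S d' → d ≡ d'
  SetDist-unique ((x , Sx , dx) , min) ((x' , Sx' , dx') , min') =
    ≤-antisym (min x' _ Sx' dx') (min' x _ Sx dx)

  module _ {S : V G → Set} where

    walk-leaving : ∀ {v x j} → ¬ S v → S x → Walk G v x j → 1 ≤ j
    walk-leaving v∉S x∈S here         = ⊥-elim (v∉S x∈S)
    walk-leaving v∉S x∈S (step _ _)   = s≤s z≤n

    walk-leaving-ball : ∀ {v x j} → ¬ S v → (∀ w → E G v w → ¬ S w) → S x → Walk G v x j → 2 ≤ j
    walk-leaving-ball v∉S N∉S x∈S here                = ⊥-elim (v∉S x∈S)
    walk-leaving-ball v∉S N∉S x∈S (step e here)       = ⊥-elim (N∉S _ e x∈S)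
    walk-leaving-ball v∉S N∉S x∈S (step _ (step _ _)) = s≤s (s≤s z≤n)

    SetDist-zero : ∀ {v} → S v → SetDist G v S 0
    SetDist-zero {v} v∈S = (v , v∈S , here , λ _ _ → z≤n) , λ _ _ _ _ → z≤n

    SetDist-zero⁻ : ∀ {v} → SetDist G v S 0 → S v
    SetDist-zero⁻ ((x , x∈S , wk , _) , _) = subst S (sym (walk-length-zero wk)) x∈S

    SetDist-one : ∀ {v} → ¬ S v → (∃ λ w → E G v w × S w) → SetDist G v S 1
    SetDist-one v∉S (w , e , w∈S) =
      (w , w∈S , step e here , λ _ → walk-leaving v∉S w∈S) ,
      λ _ _ x∈S (wk , _) → walk-leaving v∉S x∈S wk

    SetDist-one⁻ : ∀ {v} → SetDist G v S 1 → ∃ λ w → E G v w × S w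
    SetDist-one⁻ ((x , x∈S , step e here , _) , _) = x , e , x∈S

    SetDist-two : ∀ {v w x} → ¬ S v → (∀ w → E G v w → ¬ S w) →
                  E G v w → E G w x → S x → SetDist G v S 2
    SetDist-two {x = x} v∉S N∉S e e' x∈S =
      (x , x∈S , step e (step e' here) , λ _ → walk-leaving-ball v∉S N∉S x∈S) ,
      λ _ _ y∈S (wk , _) → walk-leaving-ball v∉S N∉S y∈S wk

module _ {G : Graph} {k : ℕ} (c : ProperColoring G k) where

  SeesColour : V G → Fin k → Set
  SeesColour v i = ∃ λ w → E G v w × col c w ≡ i

  Saturated : V G → Set
  Saturated v = ∀ i → col c v ≢ i → SeesColour v i

  sameCode-colour : ∀ {u v} → SameCode c u v → col c u ≡ col c v
  sameCode-colour sc = sym (SetDist-zero⁻ (Equivalence.to (sc _ 0) (SetDist-zero refl)))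

  sameCode-SetDist : ∀ {u v i d} → SameCode c u v →
                     SetDist G u (Class c i) d → SetDist G v (Class c i) d
  sameCode-SetDist sc = Equivalence.to (sc _ _)

  sameCode-sym : ∀ {u v} → SameCode c u v → SameCode c v u
  sameCode-sym sc i d = mk⇔ (Equivalence.from (sc i d)) (Equivalence.to (sc i d))

  sameCode-from-SetDist : ∀ {u v} →
    (∀ i → ∃ λ d → SetDist G u (Class c i) d × SetDist G v (Class c i) d) → SameCode c u v
  sameCode-from-SetDist both i _ with both i
  ... | _ , du , dv = mk⇔ (λ s → subst (SetDist G _ _) (SetDist-unique du s) dv)
                          (λ s → subst (SetDist G _ _) (SetDist-unique dv s) du)

  sameCode-seeing-all-but : ∀ {u v} x d → col c u ≡ col c v →
    (∀ i → col c u ≢ i → i ≢ x → SeesColour u i × SeesColour v i) →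
    SetDist G u (Class c x) d → SetDist G v (Class c x) d → SameCode c u v
  sameCode-seeing-all-but {u} {v} x d eq sees du dv = sameCode-from-SetDist dist
    where
    dist : ∀ i → ∃ λ d → SetDist G u (Class c i) d × SetDist G v (Class c i) d
    dist i with col c u Fin.≟ i | i Fin.≟ x
    ... | yes ui | _        = 0 , SetDist-zero ui , SetDist-zero (trans (sym eq) ui)
    ... | no ui  | yes refl = d , du , dv
    ... | no ui  | no i≢x with sees i ui i≢x
    ...   | sees-u , sees-v = 1 , SetDist-one ui sees-u , SetDist-one (ui ∘ trans eq) sees-v

  sameCode-saturated : ∀ {u v} → Saturated u → Saturated v → col c u ≡ col c v → SameCode c u v
  sameCode-saturated {u} su sv eq =
    sameCode-seeing-all-but (col c u) 0 eq (λ i ui _ → su i ui , sv i (ui ∘ trans eq))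
      (SetDist-zero refl) (SetDist-zero (sym eq))

module _ {m N : ℕ} {f : Fin m → Fin (suc N)} (f-injective : Injective _≡_ _≡_ f)
         {y : Fin (suc N)} (unhit : ∀ a → f a ≢ y) where

  punched : Fin m → Fin N
  punched a = punchOut (unhit a ∘ sym)

  punched-injective : Injective _≡_ _≡_ punched
  punched-injective {a} {a'} eq = f-injective (Fin.punchOut-injective (unhit a ∘ sym) (unhit a' ∘ sym) eq)

injective-onto : ∀ {m} {f : Fin m → Fin m} → Injective _≡_ _≡_ f → ∀ y → ∃ λ a → f a ≡ y
injective-onto {suc m} {f} f-injective y with Fin.any? (λ a → f a Fin.≟ y)
... | yes hit = hit
... | no unhit = ⊥-elim (1+n≰n (Fin.injective⇒≤ (punched-injective f-injective λ a e → unhit (a , e))))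

injective-onto-all-but : ∀ {m} {f : Fin m → Fin (suc m)} → Injective _≡_ _≡_ f →
  ∀ {x} → (∀ a → f a ≢ x) → ∀ y → y ≢ x → ∃ λ a → f a ≡ y
injective-onto-all-but f-injective unhit y y≢x
  with injective-onto (punched-injective f-injective unhit) (punchOut (y≢x ∘ sym))
... | a , e = a , Fin.punchOut-injective (unhit a ∘ sym) (y≢x ∘ sym) e

unhit-value : ∀ {k N} (f : Fin k → Fin N) → k < N → ∃ λ y → ∀ a → f a ≢ y
unhit-value {k} {N} f k<N with Fin.all? (λ y → Fin.any? (λ a → f a Fin.≟ y))
... | yes hit = ⊥-elim (<⇒≱ k<N (Fin.injective⇒≤ {f = proj₁ ∘ hit} preimage-injective))
  where
  preimage-injective : Injective _≡_ _≡_ (proj₁ ∘ hit)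
  preimage-injective {y} {y'} eq = trans (sym (proj₂ (hit y))) (trans (cong f eq) (proj₂ (hit y')))
... | no ¬hit with Fin.¬∀⟶∃¬ N _ (λ y → Fin.any? (λ a → f a Fin.≟ y)) ¬hit
...   | y , unhit = y , λ a e → unhit (a , e)

_∼_ : ∀ {n} → Fin n → Fin n → Set
_∼_ {n} = E (P n)

module _ {n : ℕ} where

  ∼-sym : ∀ {b b' : Fin n} → b ∼ b' → b' ∼ b
  ∼-sym (inj₁ e) = inj₂ e
  ∼-sym (inj₂ e) = inj₁ e

  ∼-irrefl : ∀ {b : Fin n} → ¬ b ∼ b
  ∼-irrefl (inj₁ e) = 1+n≢n e
  ∼-irrefl (inj₂ e) = 1+n≢n e

  _∼?_ : ∀ (b b' : Fin n) → Dec (b ∼ b')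
  b ∼? b' = (suc (toℕ b) ≟ toℕ b') ⊎-dec (suc (toℕ b') ≟ toℕ b)

  private
    same-right : ∀ {t u v : Fin n} → suc (toℕ t) ≡ toℕ u → suc (toℕ t) ≡ toℕ v → u ≡ v
    same-right tu tv = Fin.toℕ-injective (trans (sym tu) tv)

    same-left : ∀ {t u v : Fin n} → suc (toℕ u) ≡ toℕ t → suc (toℕ v) ≡ toℕ t → u ≡ v
    same-left ut vt = Fin.toℕ-injective (suc-injective (trans ut (sym vt)))

  path-neighbours : ∀ {t s p b : Fin n} → t ∼ s → t ∼ p → p ≢ s → t ∼ b → b ≡ s ⊎ b ≡ p
  path-neighbours (inj₁ ts) (inj₁ tp) p≢s _         = ⊥-elim (p≢s (same-right tp ts))
  path-neighbours (inj₂ ts) (inj₂ tp) p≢s _         = ⊥-elim (p≢s (same-left tp ts))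
  path-neighbours (inj₁ ts) (inj₂ tp) _   (inj₁ tb) = inj₁ (same-right tb ts)
  path-neighbours (inj₁ ts) (inj₂ tp) _   (inj₂ tb) = inj₂ (same-left tb tp)
  path-neighbours (inj₂ ts) (inj₁ tp) _   (inj₁ tb) = inj₂ (same-right tb tp)
  path-neighbours (inj₂ ts) (inj₁ tp) _   (inj₂ tb) = inj₁ (same-left tb ts)

  private
    step-toward-ℕ : ∀ a b {d} → ∣ a - b ∣ ≡ suc d →
      (suc a ≤ b × ∣ suc a - b ∣ ≡ d) ⊎ (∃ λ a' → suc a' ≡ a × ∣ a' - b ∣ ≡ d)
    step-toward-ℕ zero    (suc b) refl = inj₁ (s≤s z≤n , refl)
    step-toward-ℕ (suc a) zero    refl = inj₂ (a , refl , ∣-∣-identityʳ a)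
    step-toward-ℕ (suc a) (suc b) dist with step-toward-ℕ a b dist
    ... | inj₁ (a<b , dist')        = inj₁ (s≤s a<b , dist')
    ... | inj₂ (a' , refl , dist') = inj₂ (suc a' , refl , dist')

  step-toward : ∀ {d} (s q : Fin n) → ∣ toℕ s - toℕ q ∣ ≡ suc d →
                ∃ λ t → s ∼ t × ∣ toℕ t - toℕ q ∣ ≡ d
  step-toward {d} s q dist with step-toward-ℕ (toℕ s) (toℕ q) dist
  ... | inj₁ (s<q , dist') =
    fromℕ< t<n , inj₁ (sym t≡) , subst (λ z → ∣ z - toℕ q ∣ ≡ d) (sym t≡) dist'
    where
    t<n : suc (toℕ s) < n
    t<n = ≤-<-trans s<q (Fin.toℕ<n q)
    t≡ : toℕ (fromℕ< t<n) ≡ suc (toℕ s)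
    t≡ = Fin.toℕ-fromℕ< t<n
  ... | inj₂ (t , t+1≡s , dist') =
    fromℕ< t<n , inj₂ (trans (cong suc t≡) t+1≡s) , subst (λ z → ∣ z - toℕ q ∣ ≡ d) (sym t≡) dist'
    where
    t<n : t < n
    t<n = <⇒≤ (subst (_< n) (sym t+1≡s) (Fin.toℕ<n s))
    t≡ : toℕ (fromℕ< t<n) ≡ t
    t≡ = Fin.toℕ-fromℕ< t<n

module _ {m n : ℕ} where

  clique-edge : ∀ {a a' : Fin m} {b : Fin n} → a ≢ a' → E (K m □ P n) (a , b) (a' , b)
  clique-edge a≢a' = inj₂ (a≢a' , refl)

  path-edge : ∀ {a : Fin m} {b b' : Fin n} → b ∼ b' → E (K m □ P n) (a , b) (a , b')
  path-edge b∼b' = inj₁ (refl , b∼b')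

module GridColouring {m n k : ℕ} (c : ProperColoring (K m □ P n) k) where

  colour : Fin m → Fin n → Fin k
  colour a b = col c (a , b)

  layer-injective : ∀ b → Injective _≡_ _≡_ (λ a → colour a b)
  layer-injective b {a} {a'} eq with a Fin.≟ a'
  ... | yes a≡a' = a≡a'
  ... | no a≢a'  = ⊥-elim (proper c _ _ (clique-edge a≢a') eq)

  path-distinct : ∀ {a b b'} → b ∼ b' → colour a b ≢ colour a b'
  path-distinct b∼b' = proper c _ _ (path-edge b∼b')

  neighbour-colours : ∀ {a b} (Q : Fin k → Set) → (∀ a' → Q (colour a' b)) →
    (∀ {b'} → b ∼ b' → Q (colour a b')) → ∀ w → E (K m □ P n) (a , b) w → Q (col c w)
  neighbour-colours Q in-layer in-row _        (inj₁ (refl , b∼b')) = in-row b∼b'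
  neighbour-colours Q in-layer in-row (a' , _) (inj₂ (_ , refl))    = in-layer a'

  sees-in-layer : ∀ {a a' b i} → colour a b ≢ i → colour a' b ≡ i → SeesColour c (a , b) i
  sees-in-layer {a} {a'} {b} ab≢i a'b≡i =
    (a' , b) , clique-edge (λ a≡a' → ab≢i (trans (cong (λ z → colour z b) a≡a') a'b≡i)) , a'b≡i

rainbow-layers-not-locating : ∀ {m n k} → suc m ≡ k →
  (c : ProperColoring (K (suc m) □ P (suc (suc n))) k) → ¬ IsLocating c
rainbow-layers-not-locating refl c loc
  with loc _ _ (sameCode-saturated c (saturated _ _) (saturated _ _) (sym (proj₂ twin)))
  where
  open GridColouring c
  saturated : ∀ a b → Saturated c (a , b)
  saturated a b i ab≢i = sees-in-layer ab≢i (proj₂ (injective-onto (layer-injective b) i))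
  twin : ∃ λ a → colour a (Fin.suc Fin.zero) ≡ colour Fin.zero Fin.zero
  twin = injective-onto (layer-injective _) _
... | ()

rows<colours : ∀ {m n k} → 1 ≤ m → (c : ProperColoring (K m □ P (suc (suc n))) k) →
  IsLocating c → m < k
rows<colours {suc m} _ c loc =
  ≤∧≢⇒< (Fin.injective⇒≤ (GridColouring.layer-injective c Fin.zero))
        (λ m≡k → rainbow-layers-not-locating m≡k c loc)

module OneSpareColour {m n : ℕ} (c : ProperColoring (K m □ P n) (suc m)) (loc : IsLocating c) where
  open GridColouring c

  Absent : Fin n → Fin (suc m) → Set
  Absent b x = ∀ a → colour a b ≢ x

  Present : Fin n → Fin (suc m) → Set
  Present b x = ∃ λ a → colour a b ≡ x

  present? : ∀ b x → Dec (Present b x)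
  present? b x = Fin.any? (λ a → colour a b Fin.≟ x)

  absent-colour : ∀ b → ∃ (Absent b)
  absent-colour b = unhit-value (λ a → colour a b) ≤-refl

  present-unless-absent : ∀ {b x} → Absent b x → ∀ y → y ≢ x → Present b y
  present-unless-absent = injective-onto-all-but (layer-injective _)

  -- The vertex (a , t) coloured like (r , s) would be its twin: both lie at distance two
  -- from colour x and see every other colour inside their own layers.
  no-absent-pair-beside : ∀ {t s p r x} → t ∼ s → t ∼ p → p ≢ s → colour r p ≡ x →
    Absent s x → (∀ {u} → s ∼ u → Absent u x) → ⊥
  no-absent-pair-beside {t} {s} {p} {r} {x} t∼s t∼p p≢s rp≡x s-abs around-s =
    ∼-irrefl (subst (t ∼_) (sym (cong proj₂ twins)) t∼s)
    where
    t-abs : Absent t x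
    t-abs = around-s (∼-sym t∼s)

    twin : Present t (colour r s)
    twin = present-unless-absent t-abs _ (s-abs r)

    a : Fin m
    a = proj₁ twin

    a≢r : a ≢ r
    a≢r a≡r = path-distinct t∼s (subst (λ z → colour z t ≡ colour r s) a≡r (proj₂ twin))

    a-row : ∀ {b} → t ∼ b → colour a b ≢ x
    a-row t∼b with path-neighbours t∼s t∼p p≢s t∼b
    ... | inj₁ refl = s-abs a
    ... | inj₂ refl = λ ap≡x → a≢r (layer-injective p (trans ap≡x (sym rp≡x)))

    a-far : SetDist (K m □ P n) (a , t) (Class c x) 2
    a-far = SetDist-two {S = Class c x} (t-abs a) (neighbour-colours (_≢ x) t-abs a-row)
              (clique-edge a≢r) (path-edge t∼p) rp≡x

    r-far : SetDist (K m □ P n) (r , s) (Class c x) 2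
    r-far = SetDist-two {S = Class c x} (s-abs r)
              (neighbour-colours (_≢ x) s-abs (λ s∼u → around-s s∼u r))
              (path-edge (∼-sym t∼s)) (path-edge t∼p) rp≡x

    sees : ∀ i → colour a t ≢ i → i ≢ x → SeesColour c (a , t) i × SeesColour c (r , s) i
    sees i at≢i i≢x =
      sees-in-layer at≢i (proj₂ (present-unless-absent t-abs i i≢x)) ,
      sees-in-layer (at≢i ∘ trans (proj₂ twin)) (proj₂ (present-unless-absent s-abs i i≢x))

    twins : (a , t) ≡ (r , s)
    twins = loc _ _ (sameCode-seeing-all-but c x 2 (proj₂ twin) sees a-far r-far)

  absent-seen-next-door : ∀ {s x} → Absent s x → ∃ λ t → s ∼ t × Present t x
  absent-seen-next-door {s} {x} s-abs with onto c x
  ... | (r , q) , rq≡x = seen _ refl s-abs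
    where
    seen : ∀ d {s} → ∣ toℕ s - toℕ q ∣ ≡ d → Absent s x → ∃ λ t → s ∼ t × Present t x
    seen zero dist s-abs =
      ⊥-elim (s-abs r (subst (λ b → colour r b ≡ x) (sym (Fin.toℕ-injective (∣m-n∣≡0⇒m≡n dist))) rq≡x))
    seen (suc d) {s} dist s-abs with Fin.any? (λ u → (s ∼? u) ×-dec present? u x)
    ... | yes (u , s∼u , u-pre) = u , s∼u , u-pre
    ... | no none with step-toward s q dist
    ...   | t , s∼t , dist' with seen d dist' (λ a e → none (t , s∼t , a , e))
    ...     | p , t∼p , r' , r'p≡x =
      ⊥-elim (no-absent-pair-beside (∼-sym s∼t) t∼p (λ { refl → s-abs r' r'p≡x }) r'p≡x s-abs
                (λ s∼u a e → none (_ , s∼u , a , e)))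

  saturated-in-layer : ∀ b → ∃ λ a → Saturated c (a , b)
  saturated-in-layer b with absent-colour b
  ... | x , b-abs with absent-seen-next-door b-abs
  ...   | t , b∼t , r , rt≡x = r , saturated
    where
    saturated : Saturated c (r , b)
    saturated i rb≢i with i Fin.≟ x
    ... | yes refl = (r , t) , path-edge b∼t , rt≡x
    ... | no i≢x   = sees-in-layer rb≢i (proj₂ (present-unless-absent b-abs i i≢x))

  saturated-colour : Fin n → Fin (suc m)
  saturated-colour b = colour (proj₁ (saturated-in-layer b)) b

  layers≤colours : n ≤ suc m
  layers≤colours = Fin.injective⇒≤ {f = saturated-colour} λ eq →
    cong proj₂ (loc _ _ (sameCode-saturated c (proj₂ (saturated-in-layer _)) (proj₂ (saturated-in-layer _)) eq))

record Table (m n k : ℕ) : Set where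
  field
    entry            : ℕ → ℕ → ℕ
    entry<           : ∀ a j → a < m → j < n → entry a j < k
    entry-injective  : ∀ a a' j → a < m → a' < m → j < n → entry a j ≡ entry a' j → a ≡ a'
    entry-alternates : ∀ a j → a < m → suc j < n → entry a j ≢ entry a (suc j)

  colourᵗ : Fin m × Fin n → Fin k
  colourᵗ (a , b) = fromℕ< (entry< (toℕ a) (toℕ b) (Fin.toℕ<n a) (Fin.toℕ<n b))

  toℕ-colourᵗ : ∀ a b → toℕ (colourᵗ (a , b)) ≡ entry (toℕ a) (toℕ b)
  toℕ-colourᵗ a b = Fin.toℕ-fromℕ< _

  colourᵗ-≡ : ∀ {a b a' b'} → colourᵗ (a , b) ≡ colourᵗ (a' , b') →
              entry (toℕ a) (toℕ b) ≡ entry (toℕ a') (toℕ b')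
  colourᵗ-≡ {a} {b} {a'} {b'} eq = trans (sym (toℕ-colourᵗ a b)) (trans (cong toℕ eq) (toℕ-colourᵗ a' b'))

  colourᵗ-≡-in-layer : ∀ {a a' b} → colourᵗ (a , b) ≡ colourᵗ (a' , b) → a ≡ a'
  colourᵗ-≡-in-layer {a} {a'} {b} eq = Fin.toℕ-injective
    (entry-injective _ _ _ (Fin.toℕ<n a) (Fin.toℕ<n a') (Fin.toℕ<n b) (colourᵗ-≡ eq))

  colourᵗ-proper : ∀ u v → E (K m □ P n) u v → colourᵗ u ≢ colourᵗ v
  colourᵗ-proper (a , b) (_ , b') (inj₁ (refl , inj₁ b+1≡b')) eq =
    entry-alternates _ _ (Fin.toℕ<n a) (subst (_< n) (sym b+1≡b') (Fin.toℕ<n b'))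
      (trans (colourᵗ-≡ eq) (cong (entry (toℕ a)) (sym b+1≡b')))
  colourᵗ-proper (a , b) (_ , b') (inj₁ (refl , inj₂ b'+1≡b)) eq =
    entry-alternates _ _ (Fin.toℕ<n a) (subst (_< n) (sym b'+1≡b) (Fin.toℕ<n b))
      (trans (sym (colourᵗ-≡ eq)) (cong (entry (toℕ a)) (sym b'+1≡b)))
  colourᵗ-proper (a , b) (a' , _) (inj₂ (a≢a' , refl)) eq = a≢a' (colourᵗ-≡-in-layer eq)

  onto-from-entries : (∀ i → i < k → ∃ λ a → ∃ λ j → a < m × j < n × entry a j ≡ i) →
                      ∀ i → ∃ λ v → colourᵗ v ≡ i
  onto-from-entries hit i with hit (toℕ i) (Fin.toℕ<n i)
  ... | a , j , a<m , j<n , aj≡i =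
    (fromℕ< a<m , fromℕ< j<n) ,
    Fin.toℕ-injective (trans (toℕ-colourᵗ _ _)
      (trans (cong₂ entry (Fin.toℕ-fromℕ< a<m) (Fin.toℕ-fromℕ< j<n)) aj≡i))

  colouring : (∀ i → ∃ λ v → colourᵗ v ≡ i) → ProperColoring (K m □ P n) k
  colouring onto = record { col = colourᵗ ; proper = colourᵗ-proper ; onto = onto }

clique-distance : ∀ {m} → Fin m → Fin m → ℕ
clique-distance a r with a Fin.≟ r
... | yes _ = 0
... | no _  = 1

clique-distance≤1 : ∀ {m} (a r : Fin m) → clique-distance a r ≤ 1
clique-distance≤1 a r with a Fin.≟ r
... | yes _ = z≤n
... | no _  = ≤-refl

clique-distance-refl : ∀ {m} (r : Fin m) → clique-distance r r ≡ 0
clique-distance-refl r with r Fin.≟ r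
... | yes _  = refl
... | no r≢r = ⊥-elim (r≢r refl)

clique-distance-to-one-of-two : ∀ {m} {r₀ r₁ : Fin m} → r₀ ≢ r₁ → ∀ a →
  clique-distance a r₀ ⊔ clique-distance a r₁ ≡ 1
clique-distance-to-one-of-two {r₀ = r₀} {r₁} r₀≢r₁ a with a Fin.≟ r₀ | a Fin.≟ r₁
... | yes refl | yes refl = ⊥-elim (r₀≢r₁ refl)
... | yes _    | no _     = refl
... | no _     | yes _    = refl
... | no _     | no _     = refl

module Corners {m n : ℕ} where

  Grid : Graph
  Grid = K m □ P (suc n)

  corner-distance : Fin m → Fin m × Fin (suc n) → ℕ
  corner-distance r (a , b) = clique-distance a r + toℕ b

  corner-distance-edge : ∀ r {u w} → E Grid u w → corner-distance r u ≤ suc (corner-distance r w)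
  corner-distance-edge r {a , b} (inj₁ (refl , inj₁ b+1≡b')) =
    ≤-trans (+-monoʳ-≤ (clique-distance a r) (≤-trans (n≤1+n (toℕ b)) (≤-reflexive b+1≡b'))) (n≤1+n _)
  corner-distance-edge r {a , b} {_ , b'} (inj₁ (refl , inj₂ b'+1≡b)) =
    ≤-reflexive (trans (cong (clique-distance a r +_) (sym b'+1≡b)) (+-suc _ (toℕ b')))
  corner-distance-edge r {a , b} {a' , _} (inj₂ (_ , refl)) =
    ≤-trans (+-monoˡ-≤ (toℕ b) (clique-distance≤1 a r)) (s≤s (m≤n+m (toℕ b) (clique-distance a' r)))

  corner-distance-walk : ∀ r {u v j} → Walk Grid u v j → corner-distance r u ≤ j + corner-distance r v
  corner-distance-walk r here       = ≤-refl
  corner-distance-walk r (step e w) = ≤-trans (corner-distance-edge r e) (s≤s (corner-distance-walk r w))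

  corner-distance-corner : ∀ r → corner-distance r (r , Fin.zero) ≡ 0
  corner-distance-corner r = cong (_+ 0) (clique-distance-refl r)

  walk-down-from : ∀ a j (j<n : j < suc n) → Walk Grid (a , fromℕ< j<n) (a , Fin.zero) j
  walk-down-from a zero    _   = here
  walk-down-from a (suc j) j<n = step (path-edge down) (walk-down-from a j j<n')
    where
    j<n' : j < suc n
    j<n' = <⇒≤ j<n
    down : fromℕ< j<n ∼ fromℕ< j<n'
    down = inj₂ (trans (cong suc (Fin.toℕ-fromℕ< j<n')) (sym (Fin.toℕ-fromℕ< j<n)))

  walk-down-layers : ∀ a b → Walk Grid (a , b) (a , Fin.zero) (toℕ b)
  walk-down-layers a b =
    subst (λ z → Walk Grid (a , z) (a , Fin.zero) (toℕ b)) (Fin.fromℕ<-toℕ b _)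
      (walk-down-from a (toℕ b) (Fin.toℕ<n b))

  walk-to-corner : ∀ r v → Walk Grid v (r , Fin.zero) (corner-distance r v)
  walk-to-corner r (a , b) with a Fin.≟ r
  ... | yes refl = walk-down-layers a b
  ... | no a≢r   = step (clique-edge a≢r) (walk-down-layers r b)

  module _ {k : ℕ} (c : ProperColoring Grid k) where

    SingletonClass : Fin k → V Grid → Set
    SingletonClass i v = col c v ≡ i × (∀ w → col c w ≡ i → w ≡ v)

    SetDist-corner : ∀ {i r} → SingletonClass i (r , Fin.zero) →
                     ∀ v → SetDist Grid v (Class c i) (corner-distance r v)
    SetDist-corner {r = r} (ri , only) v =
      ((r , Fin.zero) , ri , walk-to-corner r v , shortest) ,
      λ w j wi (wk , _) → shortest j (subst (λ z → Walk Grid v z j) (only w wi) wk)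
      where
      shortest : ∀ j → Walk Grid v (r , Fin.zero) j → corner-distance r v ≤ j
      shortest j wk = subst (corner-distance r v ≤_)
        (trans (cong (j +_) (corner-distance-corner r)) (+-identityʳ j)) (corner-distance-walk r wk)

    two-corners⇒locating : ∀ {i₀ i₁ r₀ r₁} → r₀ ≢ r₁ →
      SingletonClass i₀ (r₀ , Fin.zero) → SingletonClass i₁ (r₁ , Fin.zero) → IsLocating c
    two-corners⇒locating {r₀ = r₀} {r₁} r₀≢r₁ s₀ s₁ (a , b) (a' , b') sc =
      cong₂ _,_ same-row same-layer
      where
      same-distance : ∀ {i r} → SingletonClass i (r , Fin.zero) →
                      corner-distance r (a , b) ≡ corner-distance r (a' , b')
      same-distance s = SetDist-unique (sameCode-SetDist c sc (SetDist-corner s _)) (SetDist-corner s _)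

      -- A vertex is off at least one of the two corner rows, which exposes its layer.
      layer-index : ∀ a b → corner-distance r₀ (a , b) ⊔ corner-distance r₁ (a , b) ≡ suc (toℕ b)
      layer-index a b = trans (sym (+-distribʳ-⊔ (toℕ b) (clique-distance a r₀) (clique-distance a r₁)))
                              (cong (_+ toℕ b) (clique-distance-to-one-of-two r₀≢r₁ a))

      same-layer : b ≡ b'
      same-layer = Fin.toℕ-injective (suc-injective (begin
        suc (toℕ b)                                                 ≡⟨ layer-index a b ⟨
        corner-distance r₀ (a , b) ⊔ corner-distance r₁ (a , b)
          ≡⟨ cong₂ _⊔_ (same-distance s₀) (same-distance s₁) ⟩
        corner-distance r₀ (a' , b') ⊔ corner-distance r₁ (a' , b') ≡⟨ layer-index a' b' ⟩
        suc (toℕ b')                                                ∎))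
        where open ≡-Reasoning

      same-row : a ≡ a'
      same-row = GridColouring.layer-injective c b'
        (subst (λ z → col c (a , z) ≡ col c (a' , b')) same-layer (sameCode-colour c sc))

cyclic-suc : ℕ → ℕ → ℕ
cyclic-suc m a with suc a ≟ m
... | yes _ = 0
... | no _  = suc a

cyclic-suc< : ∀ {m a} → a < m → cyclic-suc m a < m
cyclic-suc< {m} {a} a<m with suc a ≟ m
... | yes _     = ≤-trans (s≤s z≤n) a<m
... | no a+1≢m  = ≤∧≢⇒< a<m a+1≢m

cyclic-suc≢ : ∀ {m a} → 2 ≤ m → a < m → cyclic-suc m a ≢ a
cyclic-suc≢ {m} {a} 2≤m a<m with suc a ≟ m
... | yes a+1≡m = λ { refl → <⇒≱ (subst (_< 2) a+1≡m ≤-refl) 2≤m }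
... | no _      = 1+n≢n

cyclic-suc-injective : ∀ {m a a'} → cyclic-suc m a ≡ cyclic-suc m a' → a ≡ a'
cyclic-suc-injective {m} {a} {a'} eq with suc a ≟ m | suc a' ≟ m
... | yes a+1≡m | yes a'+1≡m = suc-injective (trans a+1≡m (sym a'+1≡m))
... | no _      | no _       = suc-injective eq
... | yes _     | no _       = ⊥-elim (1+n≢0 (sym eq))
... | no _      | yes _      = ⊥-elim (1+n≢0 eq)

cyclic-suc-onto : ∀ {m i} → i < m → ∃ λ a → a < m × cyclic-suc m a ≡ i
cyclic-suc-onto {suc m} {zero} _ = m , ≤-refl , hit
  where
  hit : cyclic-suc (suc m) m ≡ 0
  hit with suc m ≟ suc m
  ... | yes _   = refl
  ... | no m≢m  = ⊥-elim (m≢m refl)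
cyclic-suc-onto {m} {suc i} i<m = i , <⇒≤ i<m , hit
  where
  hit : cyclic-suc m i ≡ suc i
  hit with suc i ≟ m
  ... | yes i+1≡m = ⊥-elim (<-irrefl i+1≡m i<m)
  ... | no _      = refl

cycled : ℕ → ℕ → ℕ → ℕ
cycled m a zero          = a
cycled m a (suc zero)    = cyclic-suc m a
cycled m a (suc (suc j)) = cycled m a j

cycled< : ∀ {m a} j → a < m → cycled m a j < m
cycled< zero          a<m = a<m
cycled< (suc zero)    a<m = cyclic-suc< a<m
cycled< (suc (suc j)) a<m = cycled< j a<m

cycled-injective : ∀ {m a a'} j → cycled m a j ≡ cycled m a' j → a ≡ a'
cycled-injective zero          eq = eq
cycled-injective (suc zero)    eq = cyclic-suc-injective eq
cycled-injective (suc (suc j)) eq = cycled-injective j eq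

cycled-alternates : ∀ {m a} j → 2 ≤ m → a < m → cycled m a j ≢ cycled m a (suc j)
cycled-alternates zero          2≤m a<m = cyclic-suc≢ 2≤m a<m ∘ sym
cycled-alternates (suc zero)    2≤m a<m = cyclic-suc≢ 2≤m a<m
cycled-alternates (suc (suc j)) 2≤m a<m = cycled-alternates j 2≤m a<m

corner-layer : ℕ → ℕ → ℕ
corner-layer m zero          = m
corner-layer m (suc zero)    = suc m
corner-layer m (suc (suc a)) = suc (suc a)

cornered : ℕ → ℕ → ℕ → ℕ
cornered m a zero    = corner-layer m a
cornered m a (suc j) = cycled m a (suc j)

module CornerColouring (m n : ℕ) (2≤m : 2 ≤ m) where
  open Corners {m} {suc n} using (SingletonClass; two-corners⇒locating)

  cornered< : ∀ a j → a < m → cornered m a j < suc (suc m)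
  cornered< zero          zero    _   = ≤-trans (n<1+n m) (n≤1+n _)
  cornered< (suc zero)    zero    _   = ≤-refl
  cornered< (suc (suc a)) zero    a<m = ≤-trans a<m (m≤n+m m 2)
  cornered< a             (suc j) a<m = ≤-trans (cycled< (suc j) a<m) (m≤n+m m 2)

  cornered-injective : ∀ a a' j → a < m → a' < m → cornered m a j ≡ cornered m a' j → a ≡ a'
  cornered-injective a             a'             (suc j) _   _    eq = cycled-injective (suc j) eq
  cornered-injective zero          zero           zero    _   _    _  = refl
  cornered-injective (suc zero)    (suc zero)     zero    _   _    _  = refl
  cornered-injective (suc (suc a)) (suc (suc a')) zero    _   _    eq = eq
  cornered-injective zero          (suc zero)     zero    _   _    eq = ⊥-elim (1+n≢n (sym eq))
  cornered-injective (suc zero)    zero           zero    _   _    eq = ⊥-elim (1+n≢n eq)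
  cornered-injective zero          (suc (suc a')) zero    _   a'<m eq = ⊥-elim (<-irrefl (sym eq) a'<m)
  cornered-injective (suc (suc a)) zero           zero    a<m _    eq = ⊥-elim (<-irrefl eq a<m)
  cornered-injective (suc zero)    (suc (suc a')) zero    _   a'<m eq = ⊥-elim (<-irrefl (sym eq) (m<n⇒m<1+n a'<m))
  cornered-injective (suc (suc a)) (suc zero)     zero    a<m _    eq = ⊥-elim (<-irrefl eq (m<n⇒m<1+n a<m))

  cornered-alternates : ∀ a j → a < m → suc j < suc (suc n) → cornered m a j ≢ cornered m a (suc j)
  cornered-alternates zero          zero    a<m _ eq = <-irrefl (sym eq) (cyclic-suc< a<m)
  cornered-alternates (suc zero)    zero    a<m _ eq = <-irrefl (sym eq) (m<n⇒m<1+n (cyclic-suc< a<m))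
  cornered-alternates (suc (suc a)) zero    a<m _ eq = cyclic-suc≢ 2≤m a<m (sym eq)
  cornered-alternates a             (suc j) a<m _    = cycled-alternates (suc j) 2≤m a<m

  cornered-onto : ∀ i → i < suc (suc m) → ∃ λ a → ∃ λ j → a < m × j < suc (suc n) × cornered m a j ≡ i
  cornered-onto i i<m+2 with i ≟ m | i ≟ suc m
  ... | yes refl | _        = 0 , 0 , ≤-trans (s≤s z≤n) 2≤m , s≤s z≤n , refl
  ... | no _     | yes refl = 1 , 0 , 2≤m , s≤s z≤n , refl
  ... | no i≢m   | no i≢m+1 with cyclic-suc-onto i<m
    where i<m = ≤∧≢⇒< (≤-pred (≤∧≢⇒< (≤-pred i<m+2) i≢m+1)) i≢m
  ...   | a , a<m , hit = a , 1 , a<m , s≤s (s≤s z≤n) , hit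

  only-corner-has-m : ∀ a j → a < m → cornered m a j ≡ m → a ≡ 0 × j ≡ 0
  only-corner-has-m zero          zero    _   _  = refl , refl
  only-corner-has-m (suc zero)    zero    _   eq = ⊥-elim (1+n≢n eq)
  only-corner-has-m (suc (suc a)) zero    a<m eq = ⊥-elim (<-irrefl eq a<m)
  only-corner-has-m a             (suc j) a<m eq = ⊥-elim (<-irrefl eq (cycled< (suc j) a<m))

  only-corner-has-m+1 : ∀ a j → a < m → cornered m a j ≡ suc m → a ≡ 1 × j ≡ 0
  only-corner-has-m+1 zero          zero    _   eq = ⊥-elim (1+n≢n (sym eq))
  only-corner-has-m+1 (suc zero)    zero    _   _  = refl , refl
  only-corner-has-m+1 (suc (suc a)) zero    a<m eq = ⊥-elim (<-irrefl eq (m<n⇒m<1+n a<m))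
  only-corner-has-m+1 a             (suc j) a<m eq = ⊥-elim (<-irrefl eq (m<n⇒m<1+n (cycled< (suc j) a<m)))

  table : Table m (suc (suc n)) (suc (suc m))
  table = record
    { entry = cornered m ; entry< = λ a j a<m _ → cornered< a j a<m
    ; entry-injective = λ a a' j a<m a'<m _ → cornered-injective a a' j a<m a'<m
    ; entry-alternates = cornered-alternates }
  open Table table using (colourᵗ; toℕ-colourᵗ; colouring; onto-from-entries)

  corner-colouring : ProperColoring (K m □ P (suc (suc n))) (suc (suc m))
  corner-colouring = colouring (onto-from-entries cornered-onto)

  singleton : ∀ {r} (r<m : r < m) (i : Fin (suc (suc m))) →
    (∀ a j → a < m → cornered m a j ≡ toℕ i → a ≡ r × j ≡ 0) → cornered m r 0 ≡ toℕ i →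
    SingletonClass corner-colouring i (fromℕ< r<m , Fin.zero)
  singleton {r} r<m i only hit =
    Fin.toℕ-injective (trans (toℕ-colourᵗ (fromℕ< r<m) Fin.zero)
                             (trans (cong (λ a → cornered m a 0) (Fin.toℕ-fromℕ< r<m)) hit)) ,
    λ { (a , b) ab≡i → at-corner a b (only _ _ (Fin.toℕ<n a) (trans (sym (toℕ-colourᵗ a b)) (cong toℕ ab≡i))) }
    where
    at-corner : ∀ a b → toℕ a ≡ r × toℕ b ≡ 0 → (a , b) ≡ (fromℕ< r<m , Fin.zero)
    at-corner a b (a≡r , b≡0) = cong₂ _,_ (Fin.toℕ-injective (trans a≡r (sym (Fin.toℕ-fromℕ< r<m))))
                                          (Fin.toℕ-injective b≡0)

  corner-colouring-locating : HasLocatingColoring (K m □ P (suc (suc n))) (suc (suc m))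
  corner-colouring-locating = corner-colouring ,
    two-corners⇒locating corner-colouring rows-differ
      (singleton 0<m (fromℕ< m<m+2)
        (λ a j a<m e → only-corner-has-m a j a<m (trans e (Fin.toℕ-fromℕ< m<m+2))) (sym (Fin.toℕ-fromℕ< m<m+2)))
      (singleton 2≤m (fromℕ< ≤-refl)
        (λ a j a<m e → only-corner-has-m+1 a j a<m (trans e (Fin.toℕ-fromℕ< ≤-refl))) (sym (Fin.toℕ-fromℕ< ≤-refl)))
    where
    0<m : 0 < m
    0<m = ≤-trans (s≤s z≤n) 2≤m
    m<m+2 : m < suc (suc m)
    m<m+2 = ≤-trans (n<1+n m) (n≤1+n _)
    rows-differ : fromℕ< 0<m ≢ fromℕ< 2≤m
    rows-differ eq = 1+n≢0 (sym (trans (sym (Fin.toℕ-fromℕ< 0<m)) (trans (cong toℕ eq) (Fin.toℕ-fromℕ< 2≤m))))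

module _ {m n : ℕ} (T : Table m (suc (suc n)) (suc m)) where
  open Table T

  -- Twins in different layers would both see the colour missing from their own layer,
  -- hence both be gates; distinct gate colours rule this out.
  record MissingColours : Set where
    field
      missing                : ℕ → ℕ
      missing<               : ∀ j → j < suc (suc n) → missing j < suc m
      missing-absent         : ∀ a j → a < m → j < suc (suc n) → entry a j ≢ missing j
      missing-injective      : ∀ j j' → j < suc (suc n) → j' < suc (suc n) → missing j ≡ missing j' → j ≡ j'
      gate                   : ℕ → ℕ
      only-gate-sees-missing : ∀ a j j' → a < m → j < suc (suc n) → j' < suc (suc n) →
                               (suc j ≡ j' ⊎ suc j' ≡ j) → entry a j' ≡ missing j → a ≡ gate j
      gate-colours-injective : ∀ j j' → j < suc (suc n) → j' < suc (suc n) →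
                               entry (gate j) j ≡ entry (gate j') j' → j ≡ j'

  module _ (M : MissingColours) where
    open MissingColours M

    missingᶠ : Fin (suc (suc n)) → Fin (suc m)
    missingᶠ b = fromℕ< (missing< (toℕ b) (Fin.toℕ<n b))

    absent : ∀ a b → colourᵗ (a , b) ≢ missingᶠ b
    absent a b eq = missing-absent _ _ (Fin.toℕ<n a) (Fin.toℕ<n b)
      (trans (sym (toℕ-colourᵗ a b)) (trans (cong toℕ eq) (Fin.toℕ-fromℕ< _)))

    missingᶠ-injective : ∀ {b b'} → missingᶠ b ≡ missingᶠ b' → b ≡ b'
    missingᶠ-injective {b} {b'} eq = Fin.toℕ-injective (missing-injective _ _ (Fin.toℕ<n b) (Fin.toℕ<n b')
      (trans (sym (Fin.toℕ-fromℕ< _)) (trans (cong toℕ eq) (Fin.toℕ-fromℕ< _))))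

    present : ∀ b y → y ≢ missingᶠ b → ∃ λ a → colourᵗ (a , b) ≡ y
    present b = injective-onto-all-but (λ {a} {a'} → colourᵗ-≡-in-layer {a} {a'} {b}) (λ a → absent a b)

    every-colour-used : ∀ i → ∃ λ v → colourᵗ v ≡ i
    every-colour-used i with i Fin.≟ missingᶠ Fin.zero
    ... | no i≢x   = let a , e = present Fin.zero i i≢x in (a , Fin.zero) , e
    ... | yes refl = let a , e = present (Fin.suc Fin.zero) i (Fin.0≢1+n ∘ missingᶠ-injective)
                     in (a , Fin.suc Fin.zero) , e

    missing-colours-colouring : ProperColoring (K m □ P (suc (suc n))) (suc m)
    missing-colours-colouring = colouring every-colour-used

    private
      c : ProperColoring (K m □ P (suc (suc n))) (suc m)
      c = missing-colours-colouring

    sees-missing⇒gate : ∀ {a b} → SeesColour c (a , b) (missingᶠ b) → toℕ a ≡ gate (toℕ b)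
    sees-missing⇒gate {a} {b} ((_ , b') , inj₁ (refl , b∼b') , e) =
      only-gate-sees-missing _ _ _ (Fin.toℕ<n a) (Fin.toℕ<n b) (Fin.toℕ<n b') b∼b'
        (trans (sym (toℕ-colourᵗ a b')) (trans (cong toℕ e) (Fin.toℕ-fromℕ< _)))
    sees-missing⇒gate {b = b} ((a' , _) , inj₂ (_ , refl) , e) = ⊥-elim (absent a' b e)

    gate-of-twin : ∀ {a b a' b'} → SameCode c (a' , b') (a , b) → b ≢ b' → toℕ a ≡ gate (toℕ b)
    gate-of-twin {a} {b} {a'} {b'} sc b≢b' =
      sees-missing⇒gate (SetDist-one⁻ (sameCode-SetDist c sc (SetDist-one {S = Class c (missingᶠ b)} a'b'≢x sees)))
      where
      a'b'≢x : colourᵗ (a' , b') ≢ missingᶠ b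
      a'b'≢x = absent a b ∘ trans (sym (sameCode-colour c sc))
      sees : SeesColour c (a' , b') (missingᶠ b)
      sees = GridColouring.sees-in-layer c a'b'≢x (proj₂ (present b' (missingᶠ b) (b≢b' ∘ missingᶠ-injective)))

    missing-colours-locating : IsLocating c
    missing-colours-locating (a , b) (a' , b') sc with b Fin.≟ b'
    ... | yes refl = cong (_, b) (colourᵗ-≡-in-layer (sameCode-colour c sc))
    ... | no b≢b'  = ⊥-elim (b≢b' (Fin.toℕ-injective
                       (gate-colours-injective _ _ (Fin.toℕ<n b) (Fin.toℕ<n b') gates-agree)))
      where
      open ≡-Reasoning
      gates-agree : entry (gate (toℕ b)) (toℕ b) ≡ entry (gate (toℕ b')) (toℕ b')
      gates-agree = begin
        entry (gate (toℕ b)) (toℕ b)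
          ≡⟨ cong (λ z → entry z (toℕ b)) (gate-of-twin (sameCode-sym c sc) b≢b') ⟨
        entry (toℕ a) (toℕ b)          ≡⟨ colourᵗ-≡ (sameCode-colour c sc) ⟩
        entry (toℕ a') (toℕ b')        ≡⟨ cong (λ z → entry z (toℕ b')) (gate-of-twin sc (b≢b' ∘ sym)) ⟩
        entry (gate (toℕ b')) (toℕ b') ∎

  MissingColours⇒locating : MissingColours → HasLocatingColoring (K m □ P (suc (suc n))) (suc m)
  MissingColours⇒locating M = missing-colours-colouring M , missing-colours-locating M

-- Both raise j and keep m j map the rows 0 … m - 1 bijectively onto the colours 0 … m other than j.
raise : ℕ → ℕ → ℕ
raise j a with suc a ≟ j
... | yes _ = 0
... | no _  = suc a

keep : ℕ → ℕ → ℕ → ℕ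
keep m j a with a ≟ j
... | yes _ = m
... | no _  = a

raise< : ∀ {m} j {a} → a < m → raise j a < suc m
raise< j {a} a<m with suc a ≟ j
... | yes _ = s≤s z≤n
... | no _  = s≤s a<m

keep< : ∀ {m} j {a} → a < m → keep m j a < suc m
keep< j {a} a<m with a ≟ j
... | yes _ = ≤-refl
... | no _  = m<n⇒m<1+n a<m

raise-injective : ∀ j {a a'} → raise j a ≡ raise j a' → a ≡ a'
raise-injective j {a} {a'} eq with suc a ≟ j | suc a' ≟ j
... | yes a+1≡j | yes a'+1≡j = suc-injective (trans a+1≡j (sym a'+1≡j))
... | no _      | no _       = suc-injective eq
... | yes _     | no _       = ⊥-elim (1+n≢0 (sym eq))
... | no _      | yes _      = ⊥-elim (1+n≢0 eq)

keep-injective : ∀ {m} j {a a'} → a < m → a' < m → keep m j a ≡ keep m j a' → a ≡ a'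
keep-injective j {a} {a'} a<m a'<m eq with a ≟ j | a' ≟ j
... | yes a≡j | yes a'≡j = trans a≡j (sym a'≡j)
... | no _    | no _     = eq
... | yes _   | no _     = ⊥-elim (<-irrefl (sym eq) a'<m)
... | no _    | yes _    = ⊥-elim (<-irrefl eq a<m)

raise-avoids : ∀ j a → raise j a ≢ j
raise-avoids j a with suc a ≟ j
... | yes a+1≡j = λ 0≡j → 1+n≢0 (trans a+1≡j (sym 0≡j))
... | no a+1≢j  = a+1≢j

keep-avoids : ∀ {m} j {a} → a < m → keep m j a ≢ j
keep-avoids j {a} a<m with a ≟ j
... | yes a≡j = λ m≡j → <-irrefl (trans a≡j (sym m≡j)) a<m
... | no a≢j  = a≢j

raise-zero⁻ : ∀ j a → raise j a ≡ 0 → suc a ≡ j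
raise-zero⁻ j a eq with suc a ≟ j
... | yes a+1≡j = a+1≡j
... | no _      = ⊥-elim (1+n≢0 eq)

raise-suc⁻ : ∀ j a v → raise j a ≡ suc v → a ≡ v
raise-suc⁻ j a v eq with suc a ≟ j
... | yes _ = ⊥-elim (1+n≢0 (sym eq))
... | no _  = suc-injective eq

keep⁻ : ∀ m j a v → keep m j a ≡ v → (a ≡ j × m ≡ v) ⊎ a ≡ v
keep⁻ m j a v eq with a ≟ j
... | yes a≡j = inj₁ (a≡j , eq)
... | no _    = inj₂ eq

raise-self : ∀ j → raise j j ≡ suc j
raise-self j with suc j ≟ j
... | yes j+1≡j = ⊥-elim (1+n≢n j+1≡j)
... | no _      = refl

keep-below : ∀ m j → keep m (suc j) j ≡ j
keep-below m j with j ≟ suc j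
... | yes j≡j+1 = ⊥-elim (1+n≢n (sym j≡j+1))
... | no _      = refl

-- The only coincidences between raise j and keep m j' sit in row 0 of layer 1
-- and in row m - 1 of layer m - 1.
raise≢keep : ∀ {m j j' a} → 0 < m → j ≢ 1 → suc j' ≢ m → raise j a ≢ keep m j' a
raise≢keep {m} {j} {j'} {a} 0<m j≢1 j'+1≢m eq with suc a ≟ j | a ≟ j'
... | yes _     | yes _    = <-irrefl eq 0<m
... | yes a+1≡j | no _     = j≢1 (trans (sym a+1≡j) (cong suc (sym eq)))
... | no _      | yes a≡j' = j'+1≢m (trans (cong suc (sym a≡j')) eq)
... | no _      | no _     = 1+n≢n eq

0ℙ≢1ℙ : 0ℙ ≢ 1ℙ
0ℙ≢1ℙ ()

parity-suc : ∀ j → parity (suc j) ≡ parity j ⁻¹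
parity-suc j = sym (⁻¹-selfInverse (suc-homo-⁻¹ j))

parity-step : ∀ s j → parity (s + suc j) ≡ parity (s + j) ⁻¹
parity-step s j = trans (cong parity (+-suc s j)) (parity-suc (s + j))

parity-+2 : ∀ s j → parity (s + suc (suc j)) ≡ parity (s + j)
parity-+2 s j = cong parity (trans (+-suc s (suc j)) (cong suc (+-suc s j)))

parity-adjacent : ∀ s {j j'} → (suc j ≡ j' ⊎ suc j' ≡ j) → parity (s + j') ≡ parity (s + j) ⁻¹
parity-adjacent s {j}      (inj₁ refl) = parity-step s j
parity-adjacent s {_} {j'} (inj₂ refl) = sym (⁻¹-selfInverse (sym (parity-step s j')))

parity-separates : ∀ s {x y} → parity (s + x) ≡ 0ℙ → parity (s + y) ≡ 1ℙ → x ≢ y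
parity-separates s px py refl = 0ℙ≢1ℙ (trans (sym px) py)

raise-or-keep : Parity → ℕ → ℕ → ℕ → ℕ
raise-or-keep 0ℙ m a j = raise j a
raise-or-keep 1ℙ m a j = keep m j a

-- For a raised (0ℙ) or kept (1ℙ) layer j whose neighbours are of the other kind: the row
-- seeing colour j in a neighbouring layer, and the colour of that row in layer j.
gate-for : Parity → ℕ → ℕ
gate-for 0ℙ j = j
gate-for 1ℙ j = pred j

gate-value : Parity → ℕ → ℕ
gate-value 0ℙ j = suc j
gate-value 1ℙ j = pred j

module Staggered (m s : ℕ) where

  staggered : ℕ → ℕ → ℕ
  staggered a j = raise-or-keep (parity (s + j)) m a j

  staggered< : ∀ {a} j → a < m → staggered a j < suc m
  staggered< j a<m with parity (s + j)
  ... | 0ℙ = raise< j a<m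
  ... | 1ℙ = keep< j a<m

  staggered-injective : ∀ {a a'} j → a < m → a' < m → staggered a j ≡ staggered a' j → a ≡ a'
  staggered-injective j a<m a'<m with parity (s + j)
  ... | 0ℙ = raise-injective j
  ... | 1ℙ = keep-injective j a<m a'<m

  staggered-avoids : ∀ {a} j → a < m → staggered a j ≢ j
  staggered-avoids {a} j a<m with parity (s + j)
  ... | 0ℙ = raise-avoids j a
  ... | 1ℙ = keep-avoids j a<m

  raised-not-1 : ∀ {x} → parity (s + 1) ≡ 1ℙ ⊎ 2 ≤ x → parity (s + x) ≡ 0ℙ → x ≢ 1
  raised-not-1 (inj₁ 1-kept) x-raised = parity-separates s x-raised 1-kept
  raised-not-1 (inj₂ 2≤x)    _        refl = 1+n≰n 2≤x

  staggered-alternates : ∀ {a} j → 0 < m → parity (s + m) ≡ 1ℙ → parity (s + 1) ≡ 1ℙ ⊎ 2 ≤ j →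
                         a < m → staggered a j ≢ staggered a (suc j)
  staggered-alternates {a} j 0<m m-kept 1-kept⊎2≤j a<m rewrite parity-step s j with parity (s + j) in p
  ... | 0ℙ = raise≢keep 0<m (raised-not-1 1-kept⊎2≤j p) (parity-separates s (trans (parity-+2 s j) p) m-kept)
  ... | 1ℙ = raise≢keep 0<m (raised-not-1 (map₂ (λ 2≤j → ≤-trans 2≤j (n≤1+n j)) 1-kept⊎2≤j) j+1-raised)
                        (parity-separates s j+1-raised m-kept) ∘ sym
    where
    j+1-raised : parity (s + suc j) ≡ 0ℙ
    j+1-raised = trans (parity-step s j) (cong _⁻¹ p)

  staggered-seen-from-neighbour : ∀ {a j j'} → (suc j ≡ j' ⊎ suc j' ≡ j) → (parity (s + j) ≡ 0ℙ → m ≢ j) →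
                                  staggered a j' ≡ j → a ≡ gate-for (parity (s + j)) j
  staggered-seen-from-neighbour {a} {j} {j'} adj m≢j eq rewrite parity-adjacent s adj with parity (s + j)
  ... | 0ℙ with keep⁻ m j' a j eq
  ...   | inj₁ (_ , m≡j) = ⊥-elim (m≢j refl m≡j)
  ...   | inj₂ a≡j       = a≡j
  staggered-seen-from-neighbour {a} {zero}  (inj₁ refl) _ eq | 1ℙ = suc-injective (raise-zero⁻ 1 a eq)
  staggered-seen-from-neighbour {a} {suc j} _           _ eq | 1ℙ = raise-suc⁻ _ a j eq

  staggered-gate-value : ∀ j → (parity (s + j) ≡ 1ℙ → 1 ≤ j) →
                         staggered (gate-for (parity (s + j)) j) j ≡ gate-value (parity (s + j)) j
  staggered-gate-value j 1≤j with parity (s + j) in p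
  ... | 0ℙ = raise-self j
  ... | 1ℙ with 1≤j refl
  ...   | s≤s {n = j'} _ = keep-below m j'

  gate-values-injective : ∀ {j j'} → (parity (s + j) ≡ 1ℙ → 1 ≤ j) → (parity (s + j') ≡ 1ℙ → 1 ≤ j') →
    gate-value (parity (s + j)) j ≡ gate-value (parity (s + j')) j' → j ≡ j'
  gate-values-injective {j} {j'} 1≤j 1≤j' eq with parity (s + j) in p | parity (s + j') in p'
  ... | 0ℙ | 0ℙ = suc-injective eq
  ... | 1ℙ | 1ℙ with 1≤j refl | 1≤j' refl
  ...   | s≤s _ | s≤s _ = cong suc eq
  gate-values-injective {j} {j'} 1≤j 1≤j' eq | 0ℙ | 1ℙ with 1≤j' refl
  ... | s≤s _ = ⊥-elim (parity-separates s (trans (parity-+2 s j) p) p' (cong suc eq))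
  gate-values-injective {j} {j'} 1≤j 1≤j' eq | 1ℙ | 0ℙ with 1≤j refl
  ... | s≤s _ = ⊥-elim (parity-separates s (trans (parity-+2 s j') p') p (cong suc (sym eq)))

odd⇒1≤ : ∀ j → parity j ≡ 1ℙ → 1 ≤ j
odd⇒1≤ (suc j) _ = s≤s z≤n

module OddColouring (m n : ℕ) (m-odd : parity m ≡ 1ℙ) (layers≤ : suc (suc n) ≤ suc m) where
  open Staggered m 0

  table : Table m (suc (suc n)) (suc m)
  table = record
    { entry            = staggered
    ; entry<           = λ a j a<m _ → staggered< j a<m
    ; entry-injective  = λ a a' j a<m a'<m _ → staggered-injective j a<m a'<m
    ; entry-alternates = λ a j a<m _ →
        staggered-alternates j (≤-trans (s≤s z≤n) (≤-pred layers≤)) m-odd (inj₁ refl) a<m }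

  missing-colours : MissingColours table
  missing-colours = record
    { missing                = λ j → j
    ; missing<               = λ j j<n → ≤-trans j<n layers≤
    ; missing-absent         = λ a j a<m _ → staggered-avoids j a<m
    ; missing-injective      = λ _ _ _ _ eq → eq
    ; gate                   = λ j → gate-for (parity j) j
    ; only-gate-sees-missing = λ a j j' _ _ _ adj → staggered-seen-from-neighbour adj
                                 (λ j-raised m≡j → parity-separates 0 j-raised m-odd (sym m≡j))
    ; gate-colours-injective = λ j j' _ _ eq → gate-values-injective (odd⇒1≤ j) (odd⇒1≤ j')
        (trans (sym (staggered-gate-value j (odd⇒1≤ j))) (trans eq (staggered-gate-value j' (odd⇒1≤ j')))) }

  odd-colouring-locating : HasLocatingColoring (K m □ P (suc (suc n))) (suc m)
  odd-colouring-locating = MissingColours⇒locating table missing-colours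

swap : ℕ → ℕ → ℕ → ℕ
swap x y a with a ≟ x
... | yes _ = y
... | no _ with a ≟ y
...   | yes _ = x
...   | no _  = a

swap-involutive : ∀ {x y} → x ≢ y → ∀ a → swap x y (swap x y a) ≡ a
swap-involutive {x} {y} x≢y a with a ≟ x
... | yes refl with y ≟ x
...   | yes y≡x = ⊥-elim (x≢y (sym y≡x))
...   | no _ with y ≟ y
...     | yes _  = refl
...     | no y≢y = ⊥-elim (y≢y refl)
swap-involutive {x} {y} x≢y a | no a≢x with a ≟ y
...   | yes refl with x ≟ x
...     | yes _  = refl
...     | no x≢x = ⊥-elim (x≢x refl)
swap-involutive {x} {y} x≢y a | no a≢x | no a≢y with a ≟ x
...     | yes a≡x = ⊥-elim (a≢x a≡x)
...     | no _ with a ≟ y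
...       | yes a≡y = ⊥-elim (a≢y a≡y)
...       | no _    = refl

swap-injective : ∀ {x y} → x ≢ y → ∀ {a a'} → swap x y a ≡ swap x y a' → a ≡ a'
swap-injective x≢y {a} {a'} eq =
  trans (sym (swap-involutive x≢y a)) (trans (cong (swap _ _) eq) (swap-involutive x≢y a'))

swap< : ∀ {x y m a} → x < m → y < m → a < m → swap x y a < m
swap< {x} {y} {a = a} x<m y<m a<m with a ≟ x
... | yes _ = y<m
... | no _ with a ≟ y
...   | yes _ = x<m
...   | no _  = a<m

pattern 5+ k = suc (suc (suc (suc (suc k))))

-- The staggered colouring with s = 1, except that layers 1 and 4 trade their missing
-- colours and rows 2 ↔ 3 of layer 0 and rows 2 ↔ 4 of layer 1 are exchanged.
even-entry : ℕ → ℕ → ℕ → ℕ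
even-entry m a 0 = keep m 0 (swap 2 3 a)
even-entry m a 1 = raise 4 (swap 2 4 a)
even-entry m a 4 = keep m 1 a
even-entry m a j = Staggered.staggered m 1 a j

even-gate : ℕ → ℕ
even-gate 0 = 3
even-gate 1 = 4
even-gate 4 = 0
even-gate j = gate-for (parity (1 + j)) j

module EvenColouring (m n : ℕ) (m-even : parity m ≡ 0ℙ) (6≤m : 6 ≤ m) (layers≤ : suc (suc n) ≤ suc m) where
  open Staggered m 1

  literal<m : ∀ k → {True (k <? 6)} → k < m
  literal<m k {k<6} = ≤-trans (toWitness k<6) 6≤m

  m≢literal : ∀ k → {True (k <? 6)} → m ≢ k
  m≢literal k {k<6} refl = <-irrefl refl (literal<m k {k<6})

  0<m : 0 < m
  0<m = literal<m 0

  m-kept : parity (1 + m) ≡ 1ℙ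
  m-kept = trans (parity-suc m) (cong _⁻¹ m-even)

  swap₂₃< : ∀ {a} → a < m → swap 2 3 a < m
  swap₂₃< = swap< (literal<m 2) (literal<m 3)

  even-entry< : ∀ a j → a < m → even-entry m a j < suc m
  even-entry< a 0      a<m = keep< 0 (swap₂₃< a<m)
  even-entry< a 1      a<m = raise< 4 (swap< (literal<m 2) (literal<m 4) a<m)
  even-entry< a 2      a<m = staggered< 2 a<m
  even-entry< a 3      a<m = staggered< 3 a<m
  even-entry< a 4      a<m = keep< 1 a<m
  even-entry< a (5+ k) a<m = staggered< (5+ k) a<m

  even-entry-injective : ∀ a a' j → a < m → a' < m → even-entry m a j ≡ even-entry m a' j → a ≡ a'
  even-entry-injective a a' 0      a<m a'<m = swap-injective (λ ()) ∘ keep-injective 0 (swap₂₃< a<m) (swap₂₃< a'<m)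
  even-entry-injective a a' 1      a<m a'<m = swap-injective (λ ()) ∘ raise-injective 4
  even-entry-injective a a' 2      a<m a'<m = staggered-injective 2 a<m a'<m
  even-entry-injective a a' 3      a<m a'<m = staggered-injective 3 a<m a'<m
  even-entry-injective a a' 4      a<m a'<m = keep-injective 1 a<m a'<m
  even-entry-injective a a' (5+ k) a<m a'<m = staggered-injective (5+ k) a<m a'<m

  even-entry-alternates : ∀ a j → a < m → even-entry m a j ≢ even-entry m a (suc j)
  even-entry-alternates 0      0 _ = m≢literal 1
  even-entry-alternates 1      0 _ = λ ()
  even-entry-alternates 2      0 _ = λ ()
  even-entry-alternates 3      0 _ = λ ()
  even-entry-alternates 4      0 _ = λ ()
  even-entry-alternates (5+ a) 0 _ = 1+n≢n ∘ sym
  even-entry-alternates 0      1 _ = λ ()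
  even-entry-alternates 1      1 _ = λ ()
  even-entry-alternates 2      1 _ = m≢literal 5 ∘ sym
  even-entry-alternates 3      1 _ = λ ()
  even-entry-alternates 4      1 _ = λ ()
  even-entry-alternates (5+ a) 1 _ = 1+n≢n
  even-entry-alternates a 2      a<m = staggered-alternates 2 0<m m-kept (inj₂ ≤-refl) a<m
  even-entry-alternates a 3      a<m = raise≢keep 0<m (λ ()) (m≢literal 2 ∘ sym)
  even-entry-alternates a 4      a<m = raise≢keep 0<m (λ ()) (m≢literal 2 ∘ sym) ∘ sym
  even-entry-alternates a (5+ k) a<m = staggered-alternates (5+ k) 0<m m-kept (inj₂ (s≤s (s≤s z≤n))) a<m

  kept-row : ∀ {j a v} → m ≢ v → keep m j a ≡ v → a ≡ v
  kept-row {j} {a} {v} m≢v eq with keep⁻ m j a v eq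
  ... | inj₁ (_ , m≡v) = ⊥-elim (m≢v m≡v)
  ... | inj₂ a≡v       = a≡v

  swapped-row : ∀ {x y a v} → x ≢ y → swap x y a ≡ v → a ≡ swap x y v
  swapped-row {a = a} x≢y eq = trans (sym (swap-involutive x≢y a)) (cong (swap _ _) eq)

  m≢raised : ∀ {j} → parity (1 + j) ≡ 0ℙ → m ≢ j
  m≢raised j-raised m≡j = parity-separates 1 j-raised m-kept (sym m≡j)

  even-missing-absent : ∀ a j → a < m → even-entry m a j ≢ swap 1 4 j
  even-missing-absent a 0      a<m = keep-avoids 0 (swap₂₃< a<m)
  even-missing-absent a 1      a<m = raise-avoids 4 _
  even-missing-absent a 2      a<m = staggered-avoids 2 a<m
  even-missing-absent a 3      a<m = staggered-avoids 3 a<m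
  even-missing-absent a 4      a<m = keep-avoids 1 a<m
  even-missing-absent a (5+ k) a<m = staggered-avoids (5+ k) a<m

  even-only-gate-sees-missing : ∀ a j j' → (suc j ≡ j' ⊎ suc j' ≡ j) →
                                even-entry m a j' ≡ swap 1 4 j → a ≡ even-gate j
  even-only-gate-sees-missing a 0 _ (inj₁ refl) eq = swapped-row (λ ()) (suc-injective (raise-zero⁻ 4 _ eq))
  even-only-gate-sees-missing a 1 _ (inj₂ refl) eq = swapped-row (λ ()) (kept-row (m≢literal 4) eq)
  even-only-gate-sees-missing a 1 _ (inj₁ refl) eq = kept-row (m≢literal 4) eq
  even-only-gate-sees-missing a 2 _ (inj₂ refl) eq = swapped-row (λ ()) (raise-suc⁻ 4 _ 1 eq)
  even-only-gate-sees-missing a 2 _ (inj₁ refl) eq = staggered-seen-from-neighbour (inj₁ refl) (λ ()) eq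
  even-only-gate-sees-missing a 3 _ (inj₂ refl) eq = staggered-seen-from-neighbour (inj₂ refl) m≢raised eq
  even-only-gate-sees-missing a 3 _ (inj₁ refl) eq = kept-row (m≢literal 3) eq
  even-only-gate-sees-missing a 4 _ (inj₂ refl) eq = raise-suc⁻ 3 a 0 eq
  even-only-gate-sees-missing a 4 _ (inj₁ refl) eq = raise-suc⁻ 5 a 0 eq
  even-only-gate-sees-missing a (5+ zero)    _ (inj₂ refl) eq = kept-row (m≢literal 5) eq
  even-only-gate-sees-missing a (5+ (suc k)) _ (inj₂ refl) eq = staggered-seen-from-neighbour (inj₂ refl) m≢raised eq
  even-only-gate-sees-missing a (5+ k)       _ (inj₁ refl) eq = staggered-seen-from-neighbour (inj₁ refl) m≢raised eq

  gate-colour : ℕ → ℕ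
  gate-colour j = even-entry m (even-gate j) j

  small-gate-colours-injective : ∀ {j j'} → j < 5 → j' < 5 → gate-colour j ≡ gate-colour j' → j ≡ j'
  small-gate-colours-injective j<5 j'<5 =
    toWitness {a? = allUpTo? (λ j → allUpTo? (λ j' → (gate-colour j ≟ gate-colour j') →-dec (j ≟ j')) 5) 5} _
      j<5 j'<5

  small-gate-colours<5 : ∀ {j} → j < 5 → gate-colour j < 5
  small-gate-colours<5 j<5 = toWitness {a? = allUpTo? (λ j → gate-colour j <? 5) 5} _ j<5

  big-gate-colour : ∀ k → gate-colour (5+ k) ≡ gate-value (parity (6 + k)) (5+ k)
  big-gate-colour k = staggered-gate-value (5+ k) (λ _ → s≤s z≤n)

  5≤big-gate-colour : ∀ k → 5 ≤ gate-colour (5+ k)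
  5≤big-gate-colour k rewrite big-gate-colour k with parity (6 + k) in p
  ... | 0ℙ = ≤-trans (m≤m+n 5 k) (n≤1+n _)
  ... | 1ℙ with k
  ...   | suc k' = m≤m+n 5 k'

  small-or-big : ∀ j → j < 5 ⊎ ∃ λ k → j ≡ 5+ k
  small-or-big 0      = inj₁ (s≤s z≤n)
  small-or-big 1      = inj₁ (s≤s (s≤s z≤n))
  small-or-big 2      = inj₁ (s≤s (s≤s (s≤s z≤n)))
  small-or-big 3      = inj₁ (s≤s (s≤s (s≤s (s≤s z≤n))))
  small-or-big 4      = inj₁ ≤-refl
  small-or-big (5+ k) = inj₂ (k , refl)

  even-gate-colours-injective : ∀ j j' → gate-colour j ≡ gate-colour j' → j ≡ j'
  even-gate-colours-injective j j' eq with small-or-big j | small-or-big j'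
  ... | inj₁ j<5        | inj₁ j'<5         = small-gate-colours-injective j<5 j'<5 eq
  ... | inj₂ (k , refl) | inj₂ (k' , refl)  = gate-values-injective (λ _ → s≤s z≤n) (λ _ → s≤s z≤n)
                                                (trans (sym (big-gate-colour k)) (trans eq (big-gate-colour k')))
  ... | inj₁ j<5        | inj₂ (k' , refl)  =
    ⊥-elim (<⇒≱ (small-gate-colours<5 j<5) (subst (5 ≤_) (sym eq) (5≤big-gate-colour k')))
  ... | inj₂ (k , refl) | inj₁ j'<5         =
    ⊥-elim (<⇒≱ (small-gate-colours<5 j'<5) (subst (5 ≤_) eq (5≤big-gate-colour k)))

  table : Table m (suc (suc n)) (suc m)
  table = record
    { entry            = even-entry m
    ; entry<           = λ a j a<m _ → even-entry< a j a<m
    ; entry-injective  = λ a a' j a<m a'<m _ → even-entry-injective a a' j a<m a'<m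
    ; entry-alternates = λ a j a<m _ → even-entry-alternates a j a<m }

  missing-colours : MissingColours table
  missing-colours = record
    { missing                = swap 1 4
    ; missing<               = λ j j<n → swap< (s≤s 0<m) (m<n⇒m<1+n (literal<m 4)) (≤-trans j<n layers≤)
    ; missing-absent         = λ a j a<m _ → even-missing-absent a j a<m
    ; missing-injective      = λ _ _ _ _ → swap-injective (λ ())
    ; gate                   = even-gate
    ; only-gate-sees-missing = λ a j j' _ _ _ → even-only-gate-sees-missing a j j'
    ; gate-colours-injective = λ j j' _ _ → even-gate-colours-injective j j' }

  even-colouring-locating : HasLocatingColoring (K m □ P (suc (suc n))) (suc m)
  even-colouring-locating = MissingColours⇒locating table missing-colours

K₄-layer : ℕ → ℕ → ℕ
K₄-layer 0 = λ { 0 → 1 ; 1 → 2 ; 2 → 0 ; _ → 4 }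
K₄-layer 1 = λ { 0 → 0 ; 1 → 4 ; 2 → 2 ; _ → 3 }
K₄-layer 2 = λ { 0 → 1 ; 1 → 0 ; 2 → 3 ; _ → 4 }
K₄-layer 3 = λ { 0 → 4 ; 1 → 1 ; 2 → 2 ; _ → 3 }
K₄-layer _ = λ { 0 → 2 ; 1 → 0 ; 2 → 3 ; _ → 1 }

K₄-entry : ℕ → ℕ → ℕ
K₄-entry a j = K₄-layer j a

K₄-missing : ℕ → ℕ
K₄-missing = λ { 0 → 3 ; 1 → 1 ; 2 → 2 ; 3 → 0 ; _ → 4 }

K₄-gate : ℕ → ℕ
K₄-gate = λ { 0 → 3 ; 1 → 0 ; 2 → 2 ; 3 → 1 ; _ → 0 }

module K₄Colouring (n : ℕ) (layers≤5 : suc (suc n) ≤ 5) where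

  <5 : ∀ {j} → j < suc (suc n) → j < 5
  <5 j<n = ≤-trans j<n layers≤5

  table : Table 4 (suc (suc n)) 5
  table = record
    { entry            = K₄-entry
    ; entry<           = λ a j a<4 j<n →
        toWitness {a? = allUpTo? (λ a → allUpTo? (λ j → K₄-entry a j <? 5) 5) 4} _ a<4 (<5 j<n)
    ; entry-injective  = λ a a' j a<4 a'<4 j<n →
        toWitness {a? = allUpTo? (λ a → allUpTo? (λ a' → allUpTo? (λ j →
          (K₄-entry a j ≟ K₄-entry a' j) →-dec (a ≟ a')) 5) 4) 4} _ a<4 a'<4 (<5 j<n)
    ; entry-alternates = λ a j a<4 j+1<n →
        toWitness {a? = allUpTo? (λ a → allUpTo? (λ j → ¬? (K₄-entry a j ≟ K₄-entry a (suc j))) 4) 4} _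
          a<4 (≤-pred (<5 j+1<n)) }

  missing-colours : MissingColours table
  missing-colours = record
    { missing                = K₄-missing
    ; missing<               = λ j j<n → toWitness {a? = allUpTo? (λ j → K₄-missing j <? 5) 5} _ (<5 j<n)
    ; missing-absent         = λ a j a<4 j<n →
        toWitness {a? = allUpTo? (λ a → allUpTo? (λ j → ¬? (K₄-entry a j ≟ K₄-missing j)) 5) 4} _ a<4 (<5 j<n)
    ; missing-injective      = λ j j' j<n j'<n →
        toWitness {a? = allUpTo? (λ j → allUpTo? (λ j' →
          (K₄-missing j ≟ K₄-missing j') →-dec (j ≟ j')) 5) 5} _
          (<5 j<n) (<5 j'<n)
    ; gate                   = K₄-gate
    ; only-gate-sees-missing = λ a j j' a<4 j<n j'<n →
        toWitness {a? = allUpTo? (λ a → allUpTo? (λ j → allUpTo? (λ j' →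
          ((suc j ≟ j') ⊎-dec (suc j' ≟ j)) →-dec (K₄-entry a j' ≟ K₄-missing j) →-dec (a ≟ K₄-gate j))
          5) 5) 4} _
          a<4 (<5 j<n) (<5 j'<n)
    ; gate-colours-injective = λ j j' j<n j'<n →
        toWitness {a? = allUpTo? (λ j → allUpTo? (λ j' →
          (K₄-entry (K₄-gate j) j ≟ K₄-entry (K₄-gate j') j') →-dec (j ≟ j')) 5) 5} _ (<5 j<n) (<5 j'<n) }

  K₄-colouring-locating : HasLocatingColoring (K 4 □ P (suc (suc n))) 5
  K₄-colouring-locating = MissingColours⇒locating table missing-colours

m+1-colouring : ∀ m n → 3 ≤ m → suc (suc n) ≤ suc m → HasLocatingColoring (K m □ P (suc (suc n))) (suc m)
m+1-colouring m n 3≤m layers≤ with parity m in p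
... | 1ℙ = OddColouring.odd-colouring-locating m n p layers≤
... | 0ℙ = even m p 3≤m layers≤
  where
  even : ∀ m → parity m ≡ 0ℙ → 3 ≤ m → suc (suc n) ≤ suc m →
         HasLocatingColoring (K m □ P (suc (suc n))) (suc m)
  even 4            _ _ layers≤ = K₄Colouring.K₄-colouring-locating n layers≤
  even (5+ (suc k)) p _ layers≤ = EvenColouring.even-colouring-locating (6 + k) n p (m≤m+n 6 k) layers≤
  even 2 _ (s≤s (s≤s ())) _

two-spare-colours : ∀ {m n k} → 1 ≤ m → m ≤ n → (c : ProperColoring (K m □ P (suc (suc n))) k) →
  IsLocating c → suc m < k
two-spare-colours 1≤m m≤n c loc =
  ≤∧≢⇒< (rows<colours 1≤m c loc)
        (λ { refl → <⇒≱ (s≤s (s≤s m≤n)) (OneSpareColour.layers≤colours c loc) })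

theorem2 : ∀ (m n : ℕ) → 3 ≤ m → 2 ≤ n →
    (m ≤ n ∸ 2 → LocChromNum (K m □ P n) (m + 2)) ×
    (n ∸ 1 ≤ m → LocChromNum (K m □ P n) (m + 1))
theorem2 m 1 _ (s≤s ())
theorem2 m (suc (suc n)) 3≤m _ = long , short
  where
  1≤m : 1 ≤ m
  1≤m = ≤-trans (s≤s z≤n) 3≤m

  long : m ≤ n → LocChromNum (K m □ P (suc (suc n))) (m + 2)
  long m≤n rewrite +-comm m 2 =
    CornerColouring.corner-colouring-locating m n (≤-trans (s≤s (s≤s z≤n)) 3≤m) ,
    λ k (c , loc) → two-spare-colours 1≤m m≤n c loc

  short : suc n ≤ m → LocChromNum (K m □ P (suc (suc n))) (m + 1)
  short n<m rewrite +-comm m 1 =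
    m+1-colouring m n 3≤m (s≤s n<m) ,
    λ k (c , loc) → rows<colours 1≤m c loc
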